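{- Let $P=(V,\leq)$ be a finite ordered set that has an autonomous set $A$ such that $|A|\ge 2$ and $A$ is an antichain. Then any pair $(x,y)$ of distinct elements of $A$ is a $\frac12$-greedy balanced pair, i.e. $\mathbb{GP}_P(x<y)=\frac12$.
   Context: A subset $A\subseteq V$ is autonomous if for all $v\notin A$ and all $a,a'\in A$: $v<a$ implies $v<a'$, and $a<v$ implies $a'<v$. For $x\in V$, $U(x)=\{v\in V: x<v\}$. A linear extension $L=x_1<\cdots<x_n$ of $P$ is greedy if: $x_1$ is minimal in $P$; having chosen $x_1,\dots,x_i$, if no element of $U(x_i)$ is minimal in $P\setminus\{x_1,\dots,x_i\}$ (in particular if $U(x_i)=\varnothing$), then $x_{i+1}$ is any minimal element of $P\setminus\{x_1,\dots,x_i\}$; otherwise $x_{i+1}$ is an element of $U(x_i)$ minimal in $P\setminus\{x_1,\dots,x_i\}$. $\mathbb{GP}_P(x<y)$ is the number of greedy linear extensions of $P$ in which $x$ precedes $y$ divided by the total number of greedy linear extensions. An $\alpha$-greedy balanced pair is a pair $(x,y)$ with $\mathbb{GP}_P(x<y)\in[\alpha,1-\alpha]$. -}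

module Defs where

open import Level using (0ℓ)
open import Data.Nat using (ℕ)
open import Data.Fin using (Fin)
open import Data.List using (List; []; _∷_; _++_; length)
open import Data.List.Membership.Propositional using (_∈_; _∉_)
open import Data.List.Relation.Unary.Unique.Propositional using (Unique)
open import Data.Maybe using (Maybe; just; nothing)
open import Data.Product using (_×_; ∃; ∃-syntax)
open import Data.Unit using (⊤)
open import Relation.Binary using (Rel; IsPartialOrder)
open import Relation.Binary.PropositionalEquality using (_≡_; _≢_)
open import Relation.Unary using (Pred)
open import Relation.Nullary using (¬_)

module Order {n : ℕ} (_≤_ : Rel (Fin n) 0ℓ) where

  _<_ : Rel (Fin n) 0ℓ
  x < y = (x ≤ y) × (x ≢ y)

  Autonomous : Pred (Fin n) 0ℓ → Set
  Autonomous A = ∀ v a a' → ¬ A v → A a → A a' →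
    ((v < a → v < a') × (a < v → a' < v))

  Antichain : Pred (Fin n) 0ℓ → Set
  Antichain A = ∀ a b → A a → A b → a ≢ b → ¬ (a ≤ b)

  MinimalIn : List (Fin n) → Fin n → Set
  MinimalIn done z = (z ∉ done) × (∀ w → w ∉ done → ¬ (w < z))

  -- the greedy rule for the next element z after the last chosen element
  -- (nothing = no element chosen yet: z must just be minimal)
  Rule : List (Fin n) → Maybe (Fin n) → Fin n → Set
  Rule done nothing  z = ⊤
  Rule done (just x) z = (∃[ u ] ((x < u) × MinimalIn done u)) → x < z

  -- GreedyFrom done last rest : 'rest' is a valid greedy continuation after
  -- having chosen the elements of 'done' (in reverse order), last one 'last'.
  data GreedyFrom : List (Fin n) → Maybe (Fin n) → List (Fin n) → Set where
    g-end  : ∀ {done m} → (∀ v → v ∈ done) → GreedyFrom done m []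
    g-step : ∀ {done m z rest} → MinimalIn done z → Rule done m z →
             GreedyFrom (z ∷ done) (just z) rest → GreedyFrom done m (z ∷ rest)

  -- greedy linear extension x₁ < ⋯ < xₙ, given as the list [x₁, …, xₙ]
  Greedy : List (Fin n) → Set
  Greedy L = GreedyFrom [] nothing L

  Precedes : Fin n → Fin n → List (Fin n) → Set
  Precedes x y L = ∃[ as ] ∃[ bs ] ((L ≡ as ++ (x ∷ bs)) × (y ∈ bs))

  Enumerates : Pred (List (Fin n)) 0ℓ → List (List (Fin n)) → Set
  Enumerates Q Gs = Unique Gs × (∀ L → (L ∈ Gs → Q L) × (Q L → L ∈ Gs))

module Submission where

-- The transposition σ = (x y) is an automorphism of P: since A is an
-- antichain and autonomous, every element comparable with x relates to y in
-- the same way, so any permutation moving only elements of A inside A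
-- preserves the order.  An order-preserving involution maps greedy linear
-- extensions to greedy linear extensions, and L ↦ map σ L turns "x before y"
-- into "y before x".  Hence the greedy extensions split into those with x
-- before y and their images, two classes of equal size.

open import Defs
open import Level using (0ℓ)
open import Data.Nat using (ℕ; _*_; _+_)
open import Data.Nat.Properties using (+-identityʳ)
open import Data.Fin using (Fin; _≟_)
open import Data.List using (List; []; _∷_; _++_; length; map)
open import Data.List.Properties using (map-++; length-++; length-map; map-∘; map-cong; map-id)
open import Data.List.Membership.Propositional using (_∈_; _∉_)
open import Data.List.Membership.Propositional.Properties using (∈-map⁺; ∈-map⁻; ∈-++⁺ʳ; ∈-++⁺ˡ; ∈-++⁻)
open import Data.List.Membership.Propositional.Properties.WithK using (unique∧set⇒bag)
open import Data.List.Relation.Binary.BagAndSetEquality using (∼bag⇒↭)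
open import Data.List.Relation.Binary.Permutation.Propositional.Properties using (↭-length)
open import Data.List.Relation.Unary.Any using (here; there)
import Data.List.Relation.Unary.All as All
open import Data.List.Relation.Unary.AllPairs using ([]; _∷_)
open import Data.List.Relation.Unary.Unique.Propositional using (Unique)
import Data.List.Relation.Unary.Unique.Propositional.Properties as Unique
open import Data.Maybe using (just; nothing)
import Data.Maybe as Maybe
open import Data.Product using (_×_; _,_; proj₁; proj₂)
open import Data.Sum using (_⊎_; inj₁; inj₂)
import Data.Sum as Sum
open import Data.Unit using (tt)
open import Data.Empty using (⊥; ⊥-elim)
open import Function using (_∘_; mk⇔)
open import Relation.Binary using (Rel; IsPartialOrder)
open import Relation.Binary.PropositionalEquality
open import Relation.Unary using (Pred)
open import Relation.Nullary using (yes; no; ¬_; Dec)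

Involution : {T : Set} → (T → T) → Set
Involution f = ∀ t → f (f t) ≡ t

involution-injective : {T : Set} {f : T → T} → Involution f →
  ∀ {s t} → f s ≡ f t → s ≡ t
involution-injective {f = f} inv {s} {t} e = trans (sym (inv s)) (trans (cong f e) (inv t))

map-involution : {T : Set} {f : T → T} → Involution f → Involution (map f)
map-involution {f = f} inv L = begin
  map f (map f L)  ≡⟨ map-∘ L ⟨
  map (f ∘ f) L    ≡⟨ map-cong inv L ⟩
  map (λ t → t) L  ≡⟨ map-id L ⟩
  L                ∎
  where open ≡-Reasoning

module Counting {T : Set} where

  IsEnumeration : Pred T 0ℓ → List T → Set
  IsEnumeration Q Gs = Unique Gs × (∀ t → (t ∈ Gs → Q t) × (Q t → t ∈ Gs))

  enumeration-split : ∀ {Q R S Gs G₁ G₂} →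
    IsEnumeration Q Gs → IsEnumeration R G₁ → IsEnumeration S G₂ →
    (∀ {t} → Q t → R t ⊎ S t) → (∀ {t} → R t ⊎ S t → Q t) →
    (∀ {t} → R t → S t → ⊥) →
    length Gs ≡ length G₁ + length G₂
  enumeration-split {Gs = Gs} {G₁} {G₂} (uGs , eGs) (u₁ , e₁) (u₂ , e₂) split join disjoint =
    trans (↭-length (∼bag⇒↭ (unique∧set⇒bag uGs u₁₂ (mk⇔ to from)))) (length-++ G₁)
    where
    u₁₂ : Unique (G₁ ++ G₂)
    u₁₂ = Unique.++⁺ u₁ u₂ λ {t} (t∈₁ , t∈₂) → disjoint (proj₁ (e₁ t) t∈₁) (proj₁ (e₂ t) t∈₂)
    to : ∀ {t} → t ∈ Gs → t ∈ G₁ ++ G₂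
    to {t} t∈ = Sum.[ ∈-++⁺ˡ ∘ proj₂ (e₁ t) , ∈-++⁺ʳ G₁ ∘ proj₂ (e₂ t) ]
                    (split (proj₁ (eGs t) t∈))
    from : ∀ {t} → t ∈ G₁ ++ G₂ → t ∈ Gs
    from {t} t∈ = proj₂ (eGs t) (join (Sum.map (proj₁ (e₁ t)) (proj₁ (e₂ t)) (∈-++⁻ G₁ t∈)))

  enumeration-image : ∀ {Q Gs} {f : T → T} → Involution f →
    IsEnumeration Q Gs → IsEnumeration (Q ∘ f) (map f Gs)
  enumeration-image {Q} {Gs} {f} inv (uGs , eGs) =
    Unique.map⁺ (involution-injective inv) uGs , λ t → to t , from t
    where
    to : ∀ t → t ∈ map f Gs → Q (f t)
    to t t∈ with ∈-map⁻ f t∈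
    ... | s , s∈ , refl = subst Q (sym (inv s)) (proj₁ (eGs s) s∈)
    from : ∀ t → Q (f t) → t ∈ map f Gs
    from t q = subst (_∈ map f Gs) (inv t) (∈-map⁺ f (proj₂ (eGs (f t)) q))

  involution-halves : ∀ {Q P : Pred T 0ℓ} {f : T → T} {Gs GP} → Involution f →
    (∀ {t} → Q t → Q (f t)) →
    (∀ {t} → Q t → P t ⊎ P (f t)) →
    (∀ {t} → Q t → P t → ¬ P (f t)) →
    IsEnumeration Q Gs → IsEnumeration (λ t → Q t × P t) GP →
    2 * length GP ≡ length Gs
  involution-halves {Q} {P} {f} {Gs} {GP} inv Q-inv P-swap P-excl eGs eGP = begin
    2 * length GP                   ≡⟨ cong (length GP +_) (+-identityʳ (length GP)) ⟩
    length GP + length GP           ≡⟨ cong (length GP +_) (length-map f GP) ⟨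
    length GP + length (map f GP)   ≡⟨ enumeration-split eGs eGP (enumeration-image inv eGP)
                                         split join disjoint ⟨
    length Gs                       ∎
    where
    open ≡-Reasoning
    split : ∀ {t} → Q t → (Q t × P t) ⊎ (Q (f t) × P (f t))
    split q = Sum.map (q ,_) (Q-inv q ,_) (P-swap q)
    join : ∀ {t} → (Q t × P t) ⊎ (Q (f t) × P (f t)) → Q t
    join {t} = Sum.[ proj₁ , subst Q (inv t) ∘ Q-inv ∘ proj₁ ]
    disjoint : ∀ {t} → Q t × P t → Q (f t) × P (f t) → ⊥
    disjoint (q , p) (_ , p') = P-excl q p p'

module GreedyLists {n : ℕ} (_≤_ : Rel (Fin n) 0ℓ) where
  open Order _≤_

  greedy-covers : ∀ {D m R} → GreedyFrom D m R → ∀ v → v ∈ D ⊎ v ∈ R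
  greedy-covers (g-end all∈) v = inj₁ (all∈ v)
  greedy-covers (g-step _ _ g) v with greedy-covers g v
  ... | inj₁ (here refl) = inj₂ (here refl)
  ... | inj₁ (there v∈D) = inj₁ v∈D
  ... | inj₂ v∈R = inj₂ (there v∈R)

  greedy-fresh : ∀ {D m R} → GreedyFrom D m R → ∀ {w} → w ∈ R → w ∉ D
  greedy-fresh (g-step (z∉D , _) _ _) (here refl) = z∉D
  greedy-fresh (g-step _ _ g) (there w∈R) w∈D = greedy-fresh g w∈R (there w∈D)

  greedy-unique : ∀ {D m R} → GreedyFrom D m R → Unique R
  greedy-unique (g-end _) = []
  greedy-unique (g-step _ _ g) =
    All.tabulate (λ w∈R z≡w → greedy-fresh g w∈R (here (sym z≡w))) ∷ greedy-unique g

  precedes-∷ : ∀ {a b} z {L} → Precedes a b L → Precedes a b (z ∷ L)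
  precedes-∷ z (as , bs , refl , b∈) = z ∷ as , bs , refl , b∈

  precedes-uncons : ∀ {a b z L} → Precedes a b (z ∷ L) → (a ≡ z × b ∈ L) ⊎ Precedes a b L
  precedes-uncons ([] , bs , refl , b∈) = inj₁ (refl , b∈)
  precedes-uncons (_ ∷ as , bs , refl , b∈) = inj₂ (as , bs , refl , b∈)

  precedes-∈ : ∀ {a b L} → Precedes a b L → b ∈ L
  precedes-∈ (as , bs , refl , b∈) = ∈-++⁺ʳ as (there b∈)

  precedes-map : ∀ (f : Fin n → Fin n) {a b L} → Precedes a b L → Precedes (f a) (f b) (map f L)
  precedes-map f (as , bs , refl , b∈) = map f as , map f bs , map-++ f as (_ ∷ bs) , ∈-map⁺ f b∈

  precedes-total : ∀ {a b} L → a ≢ b → a ∈ L → b ∈ L → Precedes a b L ⊎ Precedes b a L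
  precedes-total (z ∷ L) a≢b (here refl) (here refl) = ⊥-elim (a≢b refl)
  precedes-total (z ∷ L) a≢b (here refl) (there b∈) = inj₁ ([] , L , refl , b∈)
  precedes-total (z ∷ L) a≢b (there a∈) (here refl) = inj₂ ([] , L , refl , a∈)
  precedes-total (z ∷ L) a≢b (there a∈) (there b∈) =
    Sum.map (precedes-∷ z) (precedes-∷ z) (precedes-total L a≢b a∈ b∈)

  precedes-asym : ∀ {a b} L → a ≢ b → Unique L → Precedes a b L → ¬ Precedes b a L
  precedes-asym [] _ _ ([] , _ , () , _)
  precedes-asym [] _ _ (_ ∷ _ , _ , () , _)
  precedes-asym (z ∷ L) a≢b (z∉L ∷ u) p q with precedes-uncons p | precedes-uncons q
  ... | inj₁ (refl , _) | inj₁ (refl , _) = a≢b refl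
  ... | inj₁ (refl , _) | inj₂ q' = All.lookup z∉L (precedes-∈ q') refl
  ... | inj₂ p' | inj₁ (refl , _) = All.lookup z∉L (precedes-∈ p') refl
  ... | inj₂ p' | inj₂ q' = precedes-asym L a≢b u p' q'

  -- Consequently a greedy linear extension, which contains every element
  -- (nothing is chosen before it starts) without repetition, orders two
  -- distinct elements in exactly one way.
  greedy-orders : ∀ {a b L} → a ≢ b → Greedy L → Precedes a b L ⊎ Precedes b a L
  greedy-orders {a} {b} {L} a≢b g with greedy-covers g a | greedy-covers g b
  ... | inj₂ a∈ | inj₂ b∈ = precedes-total L a≢b a∈ b∈

  greedy-asym : ∀ {a b L} → a ≢ b → Greedy L → Precedes a b L → ¬ Precedes b a L
  greedy-asym {L = L} a≢b g = precedes-asym L a≢b (greedy-unique g)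

module Automorphism {n : ℕ} (_≤_ : Rel (Fin n) 0ℓ)
  (σ : Fin n → Fin n) (σ-inv : Involution σ) (σ-mono : ∀ {a b} → a ≤ b → σ a ≤ σ b) where
  open Order _≤_

  σ-strict : ∀ {a b} → a < b → σ a < σ b
  σ-strict (a≤b , a≢b) = σ-mono a≤b , a≢b ∘ involution-injective σ-inv

  σ-∉ : ∀ {w D} → w ∉ D → σ w ∉ map σ D
  σ-∉ w∉D σw∈ with ∈-map⁻ σ σw∈
  ... | u , u∈D , σw≡σu = w∉D (subst (_∈ _) (sym (involution-injective σ-inv σw≡σu)) u∈D)

  minimal-map : ∀ {D z} → MinimalIn D z → MinimalIn (map σ D) (σ z)
  minimal-map {D} {z} (z∉D , z-min) = σ-∉ z∉D , λ w w∉ w<σz →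
    z-min (σ w) (λ σw∈D → w∉ (subst (_∈ map σ D) (σ-inv w) (∈-map⁺ σ σw∈D)))
          (subst (σ w <_) (σ-inv z) (σ-strict w<σz))

  minimal-map⁻ : ∀ {D u} → MinimalIn (map σ D) u → MinimalIn D (σ u)
  minimal-map⁻ {D} u-min = subst (λ E → MinimalIn E _) (map-involution σ-inv D) (minimal-map u-min)

  -- The greedy rule is invariant: a minimal upper cover of σ x' comes from one of x'.
  rule-map : ∀ {D m z} → Rule D m z → Rule (map σ D) (Maybe.map σ m) (σ z)
  rule-map {m = nothing} _ = tt
  rule-map {m = just x'} rule (u , σx'<u , u-min) =
    σ-strict (rule (σ u , subst (_< σ u) (σ-inv x') (σ-strict σx'<u) , minimal-map⁻ u-min))

  greedyFrom-map : ∀ {D m R} → GreedyFrom D m R → GreedyFrom (map σ D) (Maybe.map σ m) (map σ R)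
  greedyFrom-map {D} (g-end all∈) =
    g-end (λ v → subst (_∈ map σ D) (σ-inv v) (∈-map⁺ σ (all∈ (σ v))))
  greedyFrom-map (g-step z-min rule g) = g-step (minimal-map z-min) (rule-map rule) (greedyFrom-map g)

  greedy-map : ∀ {L} → Greedy L → Greedy (map σ L)
  greedy-map = greedyFrom-map

swap : ∀ {n} → Fin n → Fin n → Fin n → Fin n
swap x y v with v ≟ x | v ≟ y
... | yes _ | _ = y
... | no _ | yes _ = x
... | no _ | no _ = v

module _ {n : ℕ} (x y : Fin n) where

  swap-x : swap x y x ≡ y
  swap-x with x ≟ x
  ... | yes _ = refl
  ... | no x≢x = ⊥-elim (x≢x refl)

  swap-y : swap x y y ≡ x
  swap-y with y ≟ x | y ≟ y
  ... | yes y≡x | _ = y≡x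
  ... | no _ | yes _ = refl
  ... | no _ | no y≢y = ⊥-elim (y≢y refl)

  swap-other : ∀ {v} → v ≢ x → v ≢ y → swap x y v ≡ v
  swap-other {v} v≢x v≢y with v ≟ x | v ≟ y
  ... | yes v≡x | _ = ⊥-elim (v≢x v≡x)
  ... | no _ | yes v≡y = ⊥-elim (v≢y v≡y)
  ... | no _ | no _ = refl

  swap-involution : Involution (swap x y)
  swap-involution v = by-cases v (v ≟ x) (v ≟ y)
    where
    by-cases : ∀ v → Dec (v ≡ x) → Dec (v ≡ y) → swap x y (swap x y v) ≡ v
    by-cases _ (yes refl) _ = trans (cong (swap x y) swap-x) swap-y
    by-cases _ (no _) (yes refl) = trans (cong (swap x y) swap-y) swap-x
    by-cases _ (no v≢x) (no v≢y) =
      trans (cong (swap x y) (swap-other v≢x v≢y)) (swap-other v≢x v≢y)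

module AutonomousAntichain {n : ℕ} (_≤_ : Rel (Fin n) 0ℓ) (po : IsPartialOrder _≡_ _≤_)
  (A : Pred (Fin n) 0ℓ) (aut : Order.Autonomous _≤_ A) (anti : Order.Antichain _≤_ A) where
  open Order _≤_
  open IsPartialOrder po using (reflexive)

  -- An element strictly below one element of A lies outside A (antichain),
  -- hence below every element of A (autonomy).
  below-all : ∀ {v a a'} → A a → A a' → v ≢ a → v ≤ a → v ≤ a'
  below-all {v} {a} {a'} Aa Aa' v≢a v≤a =
    proj₁ (proj₁ (aut v a a' (λ Av → anti v a Av Aa v≢a v≤a) Aa Aa') (v≤a , v≢a))

  above-all : ∀ {v a a'} → A a → A a' → a ≢ v → a ≤ v → a' ≤ v
  above-all {v} {a} {a'} Aa Aa' a≢v a≤v =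
    proj₁ (proj₂ (aut v a a' (λ Av → anti a v Aa Av a≢v a≤v) Aa Aa') (a≤v , a≢v))

  PermutesWithin : (Fin n → Fin n) → Set
  PermutesWithin π = ∀ v → (A v × A (π v)) ⊎ π v ≡ v

  -- Such a π is monotone: comparable distinct elements cannot both be in A,
  -- and the one that is gets replaced by an equivalent element of A.
  permutesWithin-mono : ∀ {π} → PermutesWithin π → ∀ {a b} → a ≤ b → π a ≤ π b
  permutesWithin-mono {π} within {a} {b} a≤b with a ≟ b
  ... | yes refl = reflexive refl
  ... | no a≢b with within a | within b
  ... | inj₁ (Aa , _) | inj₁ (Ab , _) = ⊥-elim (anti a b Aa Ab a≢b a≤b)
  ... | inj₁ (Aa , Aπa) | inj₂ πb≡b = subst (π a ≤_) (sym πb≡b) (above-all Aa Aπa a≢b a≤b)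
  ... | inj₂ πa≡a | inj₁ (Ab , Aπb) = subst (_≤ π b) (sym πa≡a) (below-all Ab Aπb a≢b a≤b)
  ... | inj₂ πa≡a | inj₂ πb≡b = subst₂ _≤_ (sym πa≡a) (sym πb≡b) a≤b

  swap-permutesWithin : ∀ x y → A x → A y → PermutesWithin (swap x y)
  swap-permutesWithin x y Ax Ay v = by-cases v (v ≟ x) (v ≟ y)
    where
    by-cases : ∀ v → Dec (v ≡ x) → Dec (v ≡ y) → (A v × A (swap x y v)) ⊎ swap x y v ≡ v
    by-cases _ (yes refl) _ = inj₁ (Ax , subst A (sym (swap-x x y)) Ay)
    by-cases _ (no _) (yes refl) = inj₁ (Ay , subst A (sym (swap-y x y)) Ax)
    by-cases _ (no v≢x) (no v≢y) = inj₂ (swap-other x y v≢x v≢y)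

-- GP(x < y) = 1/2: with Gs the greedy linear extensions and Gxy those in
-- which x precedes y, the involution L ↦ map (swap x y) L halves Gs.
mainTheorem7 : (n : ℕ) (_≤_ : Rel (Fin n) 0ℓ) → IsPartialOrder _≡_ _≤_ →
    (A : Pred (Fin n) 0ℓ) → Order.Autonomous _≤_ A → Order.Antichain _≤_ A →
    (x y : Fin n) → A x → A y → x ≢ y →
    (Gs Gxy : List (List (Fin n))) →
    Order.Enumerates _≤_ (Order.Greedy _≤_) Gs →
    Order.Enumerates _≤_ (λ L → Order.Greedy _≤_ L × Order.Precedes _≤_ x y L) Gxy →
    2 * length Gxy ≡ length Gs
mainTheorem7 n _≤_ po A aut anti x y Ax Ay x≢y Gs Gxy eGs eGxy =
  Counting.involution-halves (map-involution (swap-involution x y))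
    greedy-map orders exclusive eGs eGxy
  where
  σ : Fin n → Fin n
  σ = swap x y

  open Order _≤_
  open GreedyLists _≤_
  open Automorphism _≤_ σ (swap-involution x y)
    (AutonomousAntichain.permutesWithin-mono _≤_ po A aut anti
      (AutonomousAntichain.swap-permutesWithin _≤_ po A aut anti x y Ax Ay))

  swapped : ∀ {L} → Precedes y x L → Precedes x y (map σ L)
  swapped {L} = subst₂ (λ a b → Precedes a b (map σ L)) (swap-y x y) (swap-x x y) ∘ precedes-map σ

  unswapped : ∀ {L} → Precedes x y (map σ L) → Precedes y x L
  unswapped {L} p = subst₂ (λ a b → Precedes a b L) (swap-x x y) (swap-y x y)
    (subst (Precedes (σ x) (σ y)) (map-involution (swap-involution x y) L) (precedes-map σ p))

  orders : ∀ {L} → Greedy L → Precedes x y L ⊎ Precedes x y (map σ L)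
  orders g = Sum.map₂ swapped (greedy-orders x≢y g)

  exclusive : ∀ {L} → Greedy L → Precedes x y L → ¬ Precedes x y (map σ L)
  exclusive g x<y = greedy-asym x≢y g x<y ∘ unswapped
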